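{- Let $H_3$ be the graph obtained from the complete bipartite graph $K_{2,3}$ by attaching a new pendant vertex (by a single edge) to each of the three vertices of degree 2; the three new degree-1 vertices are called the free nodes of $H_3$. Then a cellular embedding of $H_3$ in an orientable surface has a face whose boundary contains all three free nodes if and only if the embedding is nonplanar (i.e., the surface is not the sphere).
   Context: Embeddings are 2-cell (cellular) embeddings in closed orientable surfaces, equivalently given by rotation systems (a cyclic ordering of edge-ends at each vertex). -}

module Defs where

open import Data.Nat using (ℕ; zero; suc; _+_; _*_)
open import Data.Fin using (Fin)
open import Data.Product using (Σ; ∃; ∃-syntax; _×_; _,_)
open import Relation.Binary.PropositionalEquality using (_≡_)
open import Relation.Nullary using (¬_)

-- Generic combinatorial (rotation-system) notions, for a graph given by
-- a set of darts D (half-edges), a tail map to vertices V, and the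
-- fixed-point-free involution `rev` reversing a dart.

iter : {A : Set} → (A → A) → ℕ → A → A
iter f zero    x = x
iter f (suc k) x = f (iter f k x)

module Embedding {V D : Set} (tail : D → V) (rev : D → D) where

  record RotationSystem : Set where
    field
      ρ        : D → D
      ρ⁻¹      : D → D
      ρ∘ρ⁻¹    : ∀ d → ρ (ρ⁻¹ d) ≡ d
      ρ⁻¹∘ρ    : ∀ d → ρ⁻¹ (ρ d) ≡ d
      tail-ρ   : ∀ d → tail (ρ d) ≡ tail d
      cyclic   : ∀ d e → tail d ≡ tail e → ∃[ k ] iter ρ k d ≡ e

  module _ (R : RotationSystem) where
    open RotationSystem R

    φ : D → D
    φ d = ρ (rev d)

    SameFace : D → D → Set
    SameFace d e = ∃[ k ] iter φ k d ≡ e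

    HasFaces : ℕ → Set
    HasFaces k = Σ (Fin k → D) λ r →
                   (∀ d → ∃[ i ] SameFace (r i) d)
                 × (∀ i j → SameFace (r i) (r j) → i ≡ j)

    FaceContains : D → V → Set
    FaceContains d v = ∃[ e ] (SameFace d e × tail e ≡ v)

    -- orientable genus g, via Euler's formula  |V| - |E| + |F| = 2 - 2g,
    -- written as  |V| + |F| + 2g = |E| + 2
    Genus : (nV nE : ℕ) → ℕ → Set
    Genus nV nE g = ∃[ k ] (HasFaces k × nV + k + 2 * g ≡ nE + 2)

-- The graph H₃: K_{2,3} with parts {a , b} and {x 0 , x 1 , x 2},
-- plus a pendant (free) node p i attached to each x i.

data V₃ : Set where
  a b : V₃
  x p : Fin 3 → V₃

data D₃ : Set where
  a→x x→a b→x x→b x→p p→x : Fin 3 → D₃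

tail₃ : D₃ → V₃
tail₃ (a→x i) = a
tail₃ (x→a i) = x i
tail₃ (b→x i) = b
tail₃ (x→b i) = x i
tail₃ (x→p i) = x i
tail₃ (p→x i) = p i

rev₃ : D₃ → D₃
rev₃ (a→x i) = x→a i
rev₃ (x→a i) = a→x i
rev₃ (b→x i) = x→b i
rev₃ (x→b i) = b→x i
rev₃ (x→p i) = p→x i
rev₃ (p→x i) = x→p i

nV₃ nE₃ : ℕ
nV₃ = 8
nE₃ = 9

open Embedding tail₃ rev₃ public

HasFreeFace : RotationSystem → Set
HasFreeFace R = ∃[ d ] (∀ i → FaceContains R d (p i))

Planar : RotationSystem → Set
Planar R = Genus R nV₃ nE₃ 0

module Submission where

-- Every vertex of H₃ has degree 3 or 1.  At a degree-3 vertex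
-- the rotation is a cyclic permutation of three darts, so it is one of the
-- two cyclic orders; at a pendant vertex it is the identity.  Hence every
-- rotation system of H₃ agrees pointwise with one of 2⁵ = 32 explicit
-- "configurations" (one orientation bit per degree-3 vertex), and has the
-- same faces.  For each configuration the faces are computed and a
-- certificate is checked by evaluation: either all 18 darts lie on a single
-- face, or there are exactly three faces (represented by the darts a→x i),
-- none of which contains all three free nodes.  By Euler's formula
-- 8 - 9 + F = 2 - 2g, an embedding is planar iff it has three faces, so the
-- first case is "nonplanar with a free face", the second "planar without".

open import Defs
open import Data.Bool using (Bool; true; false)
open import Data.Empty using (⊥-elim)
open import Data.Fin using (Fin)
open import Data.Fin.Patterns using (0F; 1F; 2F; 3F; 4F; 5F)
open import Data.Fin.Properties using (all?; any?) renaming (_≟_ to _≟F_)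
open import Data.List using (List; []; _∷_)
open import Data.List.Membership.Propositional using (_∈_; _∉_)
open import Data.List.Relation.Unary.All as All using (All)
open import Data.List.Relation.Unary.Any using (here; there)
open import Data.Nat using (ℕ; zero; suc; _+_)
open import Data.Product using (Σ; ∃-syntax; _×_; _,_; proj₁; proj₂)
open import Data.Sum using (_⊎_; inj₁; inj₂)
open import Function.Bundles using (_⇔_; mk⇔)
open import Relation.Binary.Definitions using (DecidableEquality)
open import Relation.Binary.PropositionalEquality
open import Relation.Nullary using (¬_; Dec; contradiction)
open import Relation.Nullary.Decidable
  using (map′; from-yes; ¬?; _×-dec_; _⊎-dec_; _→-dec_)

-- 1. Orbits of a self-map

module _ {A : Set} (f : A → A) where

  -- e lies in the forward orbit of d.  For f = φ R this is exactly
  -- `SameFace R`.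
  Orbit : A → A → Set
  Orbit d e = ∃[ k ] iter f k d ≡ e

  iter-shift : ∀ k d → iter f k (f d) ≡ iter f (suc k) d
  iter-shift zero    d = refl
  iter-shift (suc k) d = cong f (iter-shift k d)

  iter-+ : ∀ k l d → iter f (k + l) d ≡ iter f k (iter f l d)
  iter-+ zero    l d = refl
  iter-+ (suc k) l d = cong f (iter-+ k l d)

  orbit-step : ∀ {d e} → Orbit (f d) e → Orbit d e
  orbit-step {d} (k , eq) = suc k , trans (sym (iter-shift k d)) eq

  orbit-trans : ∀ {d e g} → Orbit d e → Orbit e g → Orbit d g
  orbit-trans {d} (k , refl) (l , refl) = l + k , iter-+ l k d

  orbit-invariant : (P : A → Set) → (∀ z → P z → P (f z)) →
                    ∀ {d e} → P d → Orbit d e → P e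
  orbit-invariant P preserved {d} pd (k , refl) = along k
    where
    along : ∀ k → P (iter f k d)
    along zero    = pd
    along (suc k) = preserved _ (along k)

  trace : ℕ → A → List A
  trace zero    d = []
  trace (suc n) d = d ∷ trace n (f d)

  trace-orbit : ∀ n {d z} → z ∈ trace n d → Orbit d z
  trace-orbit (suc n) (here refl) = 0 , refl
  trace-orbit (suc n) (there z∈)  = orbit-step (trace-orbit n z∈)

  -- A list closed under f.  A closed list containing d contains its whole
  -- orbit, so "e ∉ L" certifies that e is not in the orbit of d.
  Closed : List A → Set
  Closed L = All (λ z → f z ∈ L) L

  closed-orbit : ∀ {L d e} → Closed L → d ∈ L → Orbit d e → e ∈ L
  closed-orbit {L} closed = orbit-invariant (_∈ L) (λ _ → All.lookup closed)

orbit-cong : {A : Set} {f g : A → A} → (∀ z → f z ≡ g z) →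
             ∀ {d e} → Orbit f d e → Orbit g d e
orbit-cong {f = f} {g} f≗g {d} (k , eq) = k , trans (sym (iter-cong k)) eq
  where
  iter-cong : ∀ k → iter f k d ≡ iter g k d
  iter-cong zero    = refl
  iter-cong (suc k) = trans (f≗g _) (cong g (iter-cong k))

iter-conj : {A B : Set} (f : B → B) (g : A → B) (σ : A → A) →
            (∀ t → f (g t) ≡ g (σ t)) → ∀ k t → iter f k (g t) ≡ g (iter σ k t)
iter-conj f g σ comm zero    t = refl
iter-conj f g σ comm (suc k) t = trans (cong f (iter-conj f g σ comm k t)) (comm _)

-- 2. Cyclic permutations of a three-element set

turn : Bool → Fin 3 → Fin 3
turn true  0F = 1F
turn true  1F = 2F
turn true  2F = 0F
turn false 0F = 2F
turn false 1F = 0F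
turn false 2F = 1F

-- An injective self-map of Fin 3 with a single orbit is one of the two
-- cyclic rotations: a fixed point or a 2-cycle would trap 0.
module _ (σ : Fin 3 → Fin 3) (inj : ∀ {s t} → σ s ≡ σ t → s ≡ t)
         (reach : ∀ t → Orbit σ 0F t) where

  private
    trapped : (P : Fin 3 → Set) → (∀ z → P z → P (σ z)) → P 0F → ∀ t → P t
    trapped P preserved p₀ t = orbit-invariant σ P preserved p₀ (reach t)

    trapped-pair : ∀ u → σ 0F ≡ u → σ u ≡ 0F → ∀ t → t ≡ 0F ⊎ t ≡ u
    trapped-pair u e₀ eᵤ = trapped (λ z → z ≡ 0F ⊎ z ≡ u) swap (inj₁ refl)
      where
      swap : ∀ z → z ≡ 0F ⊎ z ≡ u → σ z ≡ 0F ⊎ σ z ≡ u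
      swap _ (inj₁ refl) = inj₂ e₀
      swap _ (inj₂ refl) = inj₁ eᵤ

  transitive-on-3 : Σ Bool λ β → ∀ t → σ t ≡ turn β t
  transitive-on-3 with σ 0F in e₀ | σ 1F in e₁ | σ 2F in e₂
  ... | 0F | _  | _  = contradiction (trapped (_≡ 0F) (λ { _ refl → e₀ }) refl 1F) λ ()
  ... | 1F | 0F | _  = contradiction (trapped-pair 1F e₀ e₁ 2F) λ { (inj₁ ()) ; (inj₂ ()) }
  ... | 1F | 1F | _  = contradiction (inj (trans e₀ (sym e₁))) λ ()
  ... | 1F | 2F | 0F = true , λ { 0F → e₀ ; 1F → e₁ ; 2F → e₂ }
  ... | 1F | 2F | 1F = contradiction (inj (trans e₀ (sym e₂))) λ ()
  ... | 1F | 2F | 2F = contradiction (inj (trans e₁ (sym e₂))) λ ()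
  ... | 2F | _  | 0F = contradiction (trapped-pair 2F e₀ e₂ 1F) λ { (inj₁ ()) ; (inj₂ ()) }
  ... | 2F | _  | 2F = contradiction (inj (trans e₀ (sym e₂))) λ ()
  ... | 2F | 0F | 1F = false , λ { 0F → e₀ ; 1F → e₁ ; 2F → e₂ }
  ... | 2F | 1F | 1F = contradiction (inj (trans e₁ (sym e₂))) λ ()
  ... | 2F | 2F | 1F = contradiction (inj (trans e₀ (sym e₁))) λ ()

-- 3. The darts of H₃

-- Each dart is determined by its kind (one of the six constructors) and
-- its index in Fin 3; this gives decidable equality and finite
-- quantification over darts.
kind : D₃ → Fin 6
kind (a→x _) = 0F
kind (x→a _) = 1F
kind (b→x _) = 2F
kind (x→b _) = 3F
kind (x→p _) = 4F
kind (p→x _) = 5F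

index : D₃ → Fin 3
index (a→x i) = i
index (x→a i) = i
index (b→x i) = i
index (x→b i) = i
index (x→p i) = i
index (p→x i) = i

dart : Fin 6 → Fin 3 → D₃
dart 0F = a→x
dart 1F = x→a
dart 2F = b→x
dart 3F = x→b
dart 4F = x→p
dart 5F = p→x

dart-kind-index : ∀ d → dart (kind d) (index d) ≡ d
dart-kind-index (a→x _) = refl
dart-kind-index (x→a _) = refl
dart-kind-index (b→x _) = refl
dart-kind-index (x→b _) = refl
dart-kind-index (x→p _) = refl
dart-kind-index (p→x _) = refl

_≟D_ : DecidableEquality D₃
d ≟D e = map′ same-code (λ { refl → refl , refl })
              ((kind d ≟F kind e) ×-dec (index d ≟F index e))
  where
  same-code : kind d ≡ kind e × index d ≡ index e → d ≡ e
  same-code (k≡ , i≡) = trans (sym (dart-kind-index d))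
                              (trans (cong₂ dart k≡ i≡) (dart-kind-index e))

open import Data.List.Membership.DecPropositional _≟D_ using (_∈?_)

∀-dart? : {P : D₃ → Set} → (∀ d → Dec (P d)) → Dec (∀ d → P d)
∀-dart? {P} P? = map′ (λ h d → subst P (dart-kind-index d) (h (kind d) (index d)))
                      (λ h k i → h (dart k i))
                      (all? λ k → all? λ i → P? (dart k i))

fromX : Fin 3 → Fin 3 → D₃
fromX i 0F = x→a i
fromX i 1F = x→b i
fromX i 2F = x→p i

record Star (v : V₃) : Set where
  field
    leaving   : Fin 3 → D₃
    slot      : D₃ → Fin 3
    tail-leaving : ∀ t → tail₃ (leaving t) ≡ v
    slot-leaving : ∀ t → slot (leaving t) ≡ t
    leaving-slot : ∀ d → tail₃ d ≡ v → leaving (slot d) ≡ d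

starA : Star a
starA = record { leaving = a→x ; slot = index ; tail-leaving = λ _ → refl
               ; slot-leaving = λ _ → refl ; leaving-slot = at-a }
  where
  at-a : ∀ d → tail₃ d ≡ a → a→x (index d) ≡ d
  at-a (a→x _) refl = refl
  at-a (x→a _) ()
  at-a (b→x _) ()
  at-a (x→b _) ()
  at-a (x→p _) ()
  at-a (p→x _) ()

starB : Star b
starB = record { leaving = b→x ; slot = index ; tail-leaving = λ _ → refl
               ; slot-leaving = λ _ → refl ; leaving-slot = at-b }
  where
  at-b : ∀ d → tail₃ d ≡ b → b→x (index d) ≡ d
  at-b (b→x _) refl = refl
  at-b (a→x _) ()
  at-b (x→a _) ()
  at-b (x→b _) ()
  at-b (x→p _) ()
  at-b (p→x _) ()

starX : ∀ i → Star (x i)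
starX i = record { leaving = fromX i ; slot = branch
                 ; tail-leaving = λ { 0F → refl ; 1F → refl ; 2F → refl }
                 ; slot-leaving = λ { 0F → refl ; 1F → refl ; 2F → refl }
                 ; leaving-slot = at-x }
  where
  branch : D₃ → Fin 3
  branch (x→b _) = 1F
  branch (x→p _) = 2F
  branch _       = 0F
  at-x : ∀ d → tail₃ d ≡ x i → fromX i (branch d) ≡ d
  at-x (x→a _) refl = refl
  at-x (x→b _) refl = refl
  at-x (x→p _) refl = refl
  at-x (a→x _) ()
  at-x (b→x _) ()
  at-x (p→x _) ()

only-dart-at-p : ∀ i d → tail₃ d ≡ p i → d ≡ p→x i
only-dart-at-p i (p→x _) refl = refl
only-dart-at-p i (a→x _) ()
only-dart-at-p i (x→a _) ()
only-dart-at-p i (b→x _) ()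
only-dart-at-p i (x→b _) ()
only-dart-at-p i (x→p _) ()

-- 4. Configurations: the 32 rotation systems of H₃

record Config : Set where
  constructor config
  field atA atB atX₀ atX₁ atX₂ : Bool
open Config

atX : Config → Fin 3 → Bool
atX c 0F = atX₀ c
atX c 1F = atX₁ c
atX c 2F = atX₂ c

ρc : Config → D₃ → D₃
ρc c (a→x t) = a→x (turn (atA c) t)
ρc c (b→x t) = b→x (turn (atB c) t)
ρc c (x→a i) = fromX i (turn (atX c i) 0F)
ρc c (x→b i) = fromX i (turn (atX c i) 1F)
ρc c (x→p i) = fromX i (turn (atX c i) 2F)
ρc c (p→x i) = p→x i

φc : Config → D₃ → D₃
φc c d = ρc c (rev₃ d)

module _ (R : RotationSystem) where
  open RotationSystem R

  ρ-injective : ∀ {u v} → ρ u ≡ ρ v → u ≡ v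
  ρ-injective {u} {v} eq = trans (sym (ρ⁻¹∘ρ u)) (trans (cong ρ⁻¹ eq) (ρ⁻¹∘ρ v))

  local-rotation : ∀ {v} (S : Star v) →
                   Σ Bool λ β → ∀ t → ρ (Star.leaving S t) ≡ Star.leaving S (turn β t)
  local-rotation {v} S = β , λ t → trans (step t) (cong leaving (σ≗turn t))
    where
    open Star S
    σ : Fin 3 → Fin 3
    σ t = slot (ρ (leaving t))
    step : ∀ t → ρ (leaving t) ≡ leaving (σ t)
    step t = sym (leaving-slot _ (trans (tail-ρ _) (tail-leaving t)))
    σ-injective : ∀ {s t} → σ s ≡ σ t → s ≡ t
    σ-injective {s} {t} eq =
      trans (sym (slot-leaving s)) (trans (cong slot (ρ-injective
        (trans (step s) (trans (cong leaving eq) (sym (step t)))))) (slot-leaving t))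
    σ-transitive : ∀ t → Orbit σ 0F t
    σ-transitive t with cyclic (leaving 0F) (leaving t)
                               (trans (tail-leaving 0F) (sym (tail-leaving t)))
    ... | k , eq = k , trans (sym (slot-leaving _))
                         (trans (cong slot (sym (iter-conj ρ leaving σ step k 0F)))
                                (trans (cong slot eq) (slot-leaving t)))
    β : Bool
    β = proj₁ (transitive-on-3 σ σ-injective σ-transitive)
    σ≗turn : ∀ t → σ t ≡ turn β t
    σ≗turn = proj₂ (transitive-on-3 σ σ-injective σ-transitive)

  -- Opaque: the configuration of R is used only through ρ-config, and
  -- unfolding it would make the type checker evaluate faces symbolically.
  opaque
    configOf : Config
    configOf = config (proj₁ (local-rotation starA)) (proj₁ (local-rotation starB))
                      (proj₁ (local-rotation (starX 0F)))
                      (proj₁ (local-rotation (starX 1F)))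
                      (proj₁ (local-rotation (starX 2F)))

    ρ-at-x : ∀ i t → ρ (fromX i t) ≡ fromX i (turn (atX configOf i) t)
    ρ-at-x 0F = proj₂ (local-rotation (starX 0F))
    ρ-at-x 1F = proj₂ (local-rotation (starX 1F))
    ρ-at-x 2F = proj₂ (local-rotation (starX 2F))

    ρ-config : ∀ d → ρ d ≡ ρc configOf d
    ρ-config (a→x t) = proj₂ (local-rotation starA) t
    ρ-config (b→x t) = proj₂ (local-rotation starB) t
    ρ-config (x→a i) = ρ-at-x i 0F
    ρ-config (x→b i) = ρ-at-x i 1F
    ρ-config (x→p i) = ρ-at-x i 2F
    ρ-config (p→x i) = only-dart-at-p i _ (tail-ρ (p→x i))

-- 5. The faces of the 32 configurations

-- The face of d, traced for 18 = |D₃| steps, hence complete.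
face : Config → D₃ → List D₃
face c = trace (φc c) 18

OneFace : Config → Set
OneFace c = ∀ d → d ∈ face c (p→x 0F) × p→x 0F ∈ face c d

one-face-orbit : ∀ c → OneFace c → ∀ d e → Orbit (φc c) d e
one-face-orbit c one d e =
  orbit-trans (φc c) (trace-orbit (φc c) 18 (proj₂ (one d)))
                     (trace-orbit (φc c) 18 (proj₁ (one e)))

record ThreeFaces (c : Config) : Set where
  constructor three-faces
  field
    closed : ∀ d → Closed (φc c) (face c d)
    cover  : ∀ d → ∃[ i ] d ∈ face c (a→x i)
    apart  : ∀ i j → a→x j ∈ face c (a→x i) → i ≡ j
    unfree : ∀ d → ∃[ i ] p→x i ∉ face c d

OneFace? : ∀ c → Dec (OneFace c)
OneFace? c = ∀-dart? λ d → (d ∈? face c (p→x 0F)) ×-dec (p→x 0F ∈? face c d)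

ThreeFaces? : ∀ c → Dec (ThreeFaces c)
ThreeFaces? c =
  map′ (λ (h₁ , h₂ , h₃ , h₄) → three-faces h₁ h₂ h₃ h₄)
       (λ (three-faces h₁ h₂ h₃ h₄) → h₁ , h₂ , h₃ , h₄)
       (   ∀-dart? (λ d → All.all? (λ z → φc c z ∈? face c d) (face c d))
    ×-dec (∀-dart? λ d → any? λ i → d ∈? face c (a→x i))
    ×-dec (all? λ i → all? λ j → (a→x j ∈? face c (a→x i)) →-dec (i ≟F j))
    ×-dec (∀-dart? λ d → any? λ i → ¬? (p→x i ∈? face c d)))

∀-bool? : {P : Bool → Set} → (∀ b → Dec (P b)) → Dec (∀ b → P b)
∀-bool? P? = map′ (λ (t , f) → λ { true → t ; false → f })
                  (λ h → h true , h false) (P? true ×-dec P? false)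

∀-config? : {P : Config → Set} → (∀ c → Dec (P c)) → Dec (∀ c → P c)
∀-config? P? =
  map′ (λ h c → h (atA c) (atB c) (atX₀ c) (atX₁ c) (atX₂ c))
       (λ h a b x₀ x₁ x₂ → h (config a b x₀ x₁ x₂))
       (∀-bool? λ a → ∀-bool? λ b → ∀-bool? λ x₀ → ∀-bool? λ x₁ → ∀-bool? λ x₂ →
          P? (config a b x₀ x₁ x₂))

Classified : Config → Set
Classified c = OneFace c ⊎ ThreeFaces c

classified? : ∀ c → Dec (Classified c)
classified? c = OneFace? c ⊎-dec ThreeFaces? c

-- The finite check: each of the 32 configurations has one face or three.
-- Opaque, so that later uses never re-run the evaluation.
opaque
  classification : ∀ c → Classified c
  classification = from-yes (∀-config? classified?)

module _ (R : RotationSystem) where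

  C : Config
  C = configOf R

  to-config : ∀ {d e} → SameFace R d e → Orbit (φc C) d e
  to-config = orbit-cong (λ d → ρ-config R (rev₃ d))

  from-config : ∀ {d e} → Orbit (φc C) d e → SameFace R d e
  from-config = orbit-cong (λ d → sym (ρ-config R (rev₃ d)))

  planar-three-faces : Planar R → HasFaces R 3
  planar-three-faces (3 , faces , _) = faces
  planar-three-faces (0 , _ , ())
  planar-three-faces (1 , _ , ())
  planar-three-faces (2 , _ , ())
  planar-three-faces (suc (suc (suc (suc _))) , _ , ())

  -- One face: it contains every dart, in particular all free nodes, and
  -- Euler's formula rules out the sphere.
  one-face-free : OneFace C → HasFreeFace R
  one-face-free one = p→x 0F , λ i → p→x i , from-config (one-face-orbit C one _ _) , refl

  one-face-nonplanar : OneFace C → ¬ Planar R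
  one-face-nonplanar one planar with planar-three-faces planar
  ... | _ , _ , distinct =
    contradiction (distinct 0F 1F (from-config (one-face-orbit C one _ _))) λ ()

  three-faces-planar : ThreeFaces C → Planar R
  three-faces-planar three = 3 , (a→x , covered , distinct) , refl
    where
    open ThreeFaces three
    covered : ∀ d → ∃[ i ] SameFace R (a→x i) d
    covered d = proj₁ (cover d) , from-config (trace-orbit (φc C) 18 (proj₂ (cover d)))
    distinct : ∀ i j → SameFace R (a→x i) (a→x j) → i ≡ j
    distinct i j same =
      apart i j (closed-orbit (φc C) (closed (a→x i)) (here refl) (to-config same))

  three-faces-no-free : ThreeFaces C → ¬ HasFreeFace R
  three-faces-no-free three (d , contains) with ThreeFaces.unfree three d
  ... | i , missing with contains i
  ... | e , same , tail-e =
    missing (subst (_∈ face C d) (only-dart-at-p i e tail-e)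
                   (closed-orbit (φc C) (ThreeFaces.closed three d) (here refl) (to-config same)))

mainTheorem2 : (R : RotationSystem) → HasFreeFace R ⇔ (¬ Planar R)
mainTheorem2 R with classification (configOf R)
... | inj₁ one   = mk⇔ (λ _ → one-face-nonplanar R one) (λ _ → one-face-free R one)
... | inj₂ three = mk⇔ (λ free → ⊥-elim (three-faces-no-free R three free))
                       (λ nonplanar → ⊥-elim (nonplanar (three-faces-planar R three)))
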